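{- There exist infinitely many integers $n$ such that each of the five integers $n$, $n+1$, $n+2$, $n+4$, $n+5$ can be written in the form $a^2+b^2$ with $a,b$ nonzero integers. -}

module Defs where

open import Data.Integer using (ℤ; _+_; _*_)
open import Data.Product using (∃-syntax; _×_)
open import Relation.Binary.PropositionalEquality using (_≡_; _≢_)

SumTwoNonzeroSquares : ℤ → Set
SumTwoNonzeroSquares n =
  ∃[ a ] ∃[ b ] (a ≢ ℤ.pos 0 × b ≢ ℤ.pos 0 × n ≡ a * a + b * b)

-- For s ≥ 1 and n = 25s² we have n = (3s)² + (4s)², n + 1 = (5s)² + 1², n + 4 = (5s)² + 2²,
-- n + 2 = (5s − 1)² + (10s + 1) and n + 5 = (5s − 2)² + (20s + 1). So it suffices to find
-- arbitrarily large s for which 10s + 1 = w² and 20s + 1 = v² are both squares. Such pairs satisfy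
-- v² − 2w² = −1, and multiplying v + w√2 by the unit 99 + 70√2 = (1 + √2)⁶ turns one into another
-- with larger s, starting from s = 0, v = w = 1.
module Submission where

open import Defs
open import Data.Product using (∃-syntax; _×_; _,_)
open import Relation.Binary.PropositionalEquality

module _ where
  open import Data.List using (_∷_; [])
  open import Data.Nat
  open import Data.Nat.Properties
  open import Data.Nat.Tactic.RingSolver using (solve)

  record Admissible (s : ℕ) : Set where
    constructor admissible
    field
      v w : ℕ
      v²≡ : v * v ≡ 1 + 20 * s
      w²≡ : w * w ≡ 1 + 10 * s

  square-of-combination : ∀ a b {s v w} → v * v ≡ 1 + 20 * s → w * w ≡ 1 + 10 * s →
    (a * v + b * w) * (a * v + b * w) ≡ a * a * (1 + 20 * s) + 2 * a * b * (v * w) + b * b * (1 + 10 * s)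
  square-of-combination a b {s} {v} {w} v²≡ w²≡ = begin
    (a * v + b * w) * (a * v + b * w)
      ≡⟨ solve (a ∷ b ∷ v ∷ w ∷ []) ⟩
    a * a * (v * v) + 2 * a * b * (v * w) + b * b * (w * w)
      ≡⟨ cong₂ (λ x y → a * a * x + 2 * a * b * (v * w) + b * b * y) v²≡ w²≡ ⟩
    a * a * (1 + 20 * s) + 2 * a * b * (v * w) + b * b * (1 + 10 * s) ∎
    where open ≡-Reasoning

  pell-step : ∀ {s v w} → v * v ≡ 1 + 20 * s → w * w ≡ 1 + 10 * s →
    let s′ = 19601 * s + 1470 + 1386 * (v * w) in
    (99 * v + 140 * w) * (99 * v + 140 * w) ≡ 1 + 20 * s′ ×
    (70 * v + 99 * w) * (70 * v + 99 * w) ≡ 1 + 10 * s′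
  pell-step {s} {v} {w} v²≡ w²≡ =
    trans (square-of-combination 99 140 {s} {v} {w} v²≡ w²≡) (solve (s ∷ v ∷ w ∷ [])) ,
    trans (square-of-combination 70 99 {s} {v} {w} v²≡ w²≡) (solve (s ∷ v ∷ w ∷ []))

  next : ∀ {s} → Admissible s → ℕ
  next {s} (admissible v w _ _) = 19601 * s + 1470 + 1386 * (v * w)

  admissible-next : ∀ {s} (a : Admissible s) → Admissible (next a)
  admissible-next {s} (admissible v w v²≡ w²≡) =
    let v′²≡ , w′²≡ = pell-step {s} {v} {w} v²≡ w²≡ in
    admissible (99 * v + 140 * w) (70 * v + 99 * w) v′²≡ w′²≡

  <-next : ∀ {s} (a : Admissible s) → s < next a
  <-next {s} (admissible v w _ _) = begin-strict
    s                                  ≤⟨ m≤n*m s 19601 ⟩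
    19601 * s                          <⟨ m<m+n _ z<s ⟩
    19601 * s + 1470                   ≤⟨ m≤m+n _ _ ⟩
    19601 * s + 1470 + 1386 * (v * w)  ∎
    where open ≤-Reasoning

  admissible-unbounded : ∀ k → ∃[ s ] (k < s × Admissible s)
  admissible-unbounded zero = next a₀ , <-next a₀ , admissible-next a₀
    where
    a₀ : Admissible 0
    a₀ = admissible 1 1 refl refl
  admissible-unbounded (suc k) with admissible-unbounded k
  ... | s , k<s , a = next a , ≤-<-trans k<s (<-next a) , admissible-next a

  NonzeroSquareSum : ℕ → Set
  NonzeroSquareSum n = ∃[ a ] ∃[ b ] (a ≢ 0 × b ≢ 0 × n ≡ a * a + b * b)

  x*x≡suc⇒x≢0 : ∀ {x k} → x * x ≡ suc k → x ≢ 0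
  x*x≡suc⇒x≢0 () refl

  sums-of-squares-near-25s² : ∀ r → Admissible (suc r) →
    let n = 25 * (suc r * suc r) in
    NonzeroSquareSum n × NonzeroSquareSum (n + 1) × NonzeroSquareSum (n + 2) ×
    NonzeroSquareSum (n + 4) × NonzeroSquareSum (n + 5)
  -- s = 1 + r, so that 5s − 1 = 4 + 5r and 5s − 2 = 3 + 5r need no truncated subtraction
  sums-of-squares-near-25s² r (admissible v w v²≡ w²≡) =
    (3 * suc r , 4 * suc r , (λ ()) , (λ ()) , solve (r ∷ [])) ,
    (5 * suc r , 1 , (λ ()) , (λ ()) , solve (r ∷ [])) ,
    (4 + 5 * r , w , (λ ()) , x*x≡suc⇒x≢0 w²≡ , n+2≡) ,
    (5 * suc r , 2 , (λ ()) , (λ ()) , solve (r ∷ [])) ,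
    (3 + 5 * r , v , (λ ()) , x*x≡suc⇒x≢0 v²≡ , n+5≡)
    where
    open ≡-Reasoning
    n+2≡ : 25 * (suc r * suc r) + 2 ≡ (4 + 5 * r) * (4 + 5 * r) + w * w
    n+2≡ = begin
      25 * (suc r * suc r) + 2                        ≡⟨ solve (r ∷ []) ⟩
      (4 + 5 * r) * (4 + 5 * r) + (1 + 10 * suc r)    ≡⟨ cong ((4 + 5 * r) * (4 + 5 * r) +_) w²≡ ⟨
      (4 + 5 * r) * (4 + 5 * r) + w * w               ∎
    n+5≡ : 25 * (suc r * suc r) + 5 ≡ (3 + 5 * r) * (3 + 5 * r) + v * v
    n+5≡ = begin
      25 * (suc r * suc r) + 5                        ≡⟨ solve (r ∷ []) ⟩
      (3 + 5 * r) * (3 + 5 * r) + (1 + 20 * suc r)    ≡⟨ cong ((3 + 5 * r) * (3 + 5 * r) +_) v²≡ ⟨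
      (3 + 5 * r) * (3 + 5 * r) + v * v               ∎

open import Data.Nat as ℕ using (ℕ; suc)
import Data.Nat.Properties as ℕ
open import Data.Integer using (ℤ; _+_; _<_; +_; -[1+_]; ∣_∣; +<+; -<+)
open import Data.Integer.Properties using (pos-+; pos-*; +-injective)

+-sumTwoNonzeroSquares : ∀ {n} → NonzeroSquareSum n → SumTwoNonzeroSquares (+ n)
+-sumTwoNonzeroSquares (a , b , a≢0 , b≢0 , refl) =
  + a , + b , (λ eq → a≢0 (+-injective eq)) , (λ eq → b≢0 (+-injective eq)) ,
  trans (pos-+ (a ℕ.* a) (b ℕ.* b)) (cong₂ _+_ (pos-* a a) (pos-* b b))

∣i∣<n⇒i<+n : ∀ i {n} → ∣ i ∣ ℕ.< n → i < + n
∣i∣<n⇒i<+n (+ _)      ∣i∣<n = +<+ ∣i∣<n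
∣i∣<n⇒i<+n -[1+ _ ]   _     = -<+

theorem3p3 : ∀ (m : ℤ) → ∃[ n ] (m < n × SumTwoNonzeroSquares n × SumTwoNonzeroSquares (n + ℤ.pos 1) × SumTwoNonzeroSquares (n + ℤ.pos 2) × SumTwoNonzeroSquares (n + ℤ.pos 4) × SumTwoNonzeroSquares (n + ℤ.pos 5))
theorem3p3 m with admissible-unbounded ∣ m ∣
... | suc r , ∣m∣<s , a =
  let n₀ , n₁ , n₂ , n₄ , n₅ = sums-of-squares-near-25s² r a in
  + n , ∣i∣<n⇒i<+n m ∣m∣<n ,
  +-sumTwoNonzeroSquares n₀ , +-sumTwoNonzeroSquares n₁ , +-sumTwoNonzeroSquares n₂ ,
  +-sumTwoNonzeroSquares n₄ , +-sumTwoNonzeroSquares n₅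
  where
  n : ℕ
  n = 25 ℕ.* (suc r ℕ.* suc r)
  ∣m∣<n : ∣ m ∣ ℕ.< n
  ∣m∣<n = ℕ.<-≤-trans ∣m∣<s (ℕ.≤-trans (ℕ.m≤m*n (suc r) (suc r)) (ℕ.m≤n*m _ 25))
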